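{- Let $G$ be a chordal graph and $X\subseteq V(G)$ a clique, and let $L_1,\dots,L_t$ be the evaporation sequence of $G$ with exception set $X$. Let $C=V(G)\setminus X$. If $G\setminus X$ is connected, then $N(C)=N(L_t)\cap X$.
   Context: A vertex is simplicial if its neighborhood is a clique. For a chordal graph $G$ and a clique $X\subseteq V(G)$, the evaporation sequence of $G$ with exception set $X$ is defined recursively: if $X=V(G)$ it is the empty sequence; otherwise let $L_1$ be the set of simplicial vertices of $G$ minus $X$ (this is nonempty), and the sequence is $L_1$ followed by the evaporation sequence of $G\setminus L_1$ (the induced subgraph on $V(G)\setminus L_1$) with exception set $X$. For $S\subseteq V(G)$, $N(S)=\{v\in V(G)\setminus S: uv\in E(G)\text{ for some }u\in S\}$. $G\setminus X$ denotes the subgraph induced on $V(G)\setminus X$. -}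

module Defs where

open import Level using (0ℓ)
open import Data.Nat using (ℕ; suc; _≥_; _∸_)
open import Data.Fin using (Fin; toℕ)
open import Data.Fin.Subset using (Subset; _∈_; _∉_; _─_; ∁; ⊤) public
open import Data.Product using (Σ; ∃; _×_; _,_)
open import Data.List using (List; []; _∷_)
open import Function.Definitions using (Injective)
open import Relation.Binary.PropositionalEquality using (_≡_; _≢_)
open import Relation.Nullary using (¬_; Dec)
open import Data.Sum using (_⊎_)
open import Function.Bundles using (_⇔_)

record Graph (n : ℕ) : Set₁ where
  field
    Adj     : Fin n → Fin n → Set
    adj?    : ∀ u v → Dec (Adj u v)
    symAdj  : ∀ {u v} → Adj u v → Adj v u
    irrefl  : ∀ {u} → ¬ Adj u u
open Graph public

module _ {n : ℕ} (G : Graph n) where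

  CycSucc : {k : ℕ} → Fin k → Fin k → Set
  CycSucc {k} i j = (toℕ j ≡ suc (toℕ i)) ⊎ ((toℕ i ≡ k ∸ 1) × (toℕ j ≡ 0))

  record ChordlessCycle (k : ℕ) : Set where
    field
      c        : Fin k → Fin n
      distinct : Injective _≡_ _≡_ c
      edges    : ∀ i j → CycSucc i j → Adj G (c i) (c j)
      noChord  : ∀ i j → Adj G (c i) (c j) → CycSucc i j ⊎ CycSucc j i

  Chordal : Set
  Chordal = ∀ k → k ≥ 4 → ¬ ChordlessCycle k

  IsClique : Subset n → Set
  IsClique X = ∀ u v → u ∈ X → v ∈ X → u ≢ v → Adj G u v

  SimplicialIn : Subset n → Fin n → Set
  SimplicialIn S v = v ∈ S × (∀ u w → u ∈ S → w ∈ S → u ≢ w → Adj G v u → Adj G v w → Adj G u w)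

  -- Evap X S Ls : Ls is the evaporation sequence of G[S] with exception set X
  data Evap (X : Subset n) : Subset n → List (Subset n) → Set where
    done : ∀ {S} → S ≡ X → Evap X S []
    step : ∀ {S L Ls} → S ≢ X
         → (∀ v → (v ∈ L) ⇔ (SimplicialIn S v × v ∉ X))
         → Evap X (S ─ L) Ls
         → Evap X S (L ∷ Ls)

  data WalkIn (C : Subset n) : Fin n → Fin n → Set where
    here  : ∀ {u} → u ∈ C → WalkIn C u u
    there : ∀ {u v w} → u ∈ C → Adj G u v → WalkIn C v w → WalkIn C u w

  ConnectedIn : Subset n → Set
  ConnectedIn C = (∃ λ v → v ∈ C) × (∀ u w → u ∈ C → w ∈ C → WalkIn C u w)

  Nbhd : Subset n → Fin n → Set
  Nbhd S v = v ∉ S × (∃ λ u → u ∈ S × Adj G u v)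

{-# OPTIONS --safe #-}
-- Evaporating a layer L of simplicial vertices keeps G \ X connected: a walk
-- through x ∈ L can skip x, since the two walk-neighbours of x are adjacent (or
-- equal).  It also keeps every v ∈ X with a neighbour outside X adjacent to a
-- surviving vertex outside X: walk from that neighbour towards a survivor; while
-- the current vertex lies in L, its successor is adjacent to v by simpliciality.
-- So the invariant persists until only Lₜ is left, where all such neighbours sit.
-- Chordality and the clique condition only guarantee that the evaporation
-- sequence exists; here it is given.
module Submission where

open import Defs
open import Data.Nat using (ℕ)
open import Data.Fin using (Fin; _≟_)
open import Data.Fin.Properties using (any?)
open import Data.Fin.Subset using (_⊆_; Nonempty; inside; outside)
open import Data.Fin.Subset.Properties
  using (_∈?_; ∈⊤; ⊆-antisym; x∈∁p⇒x∉p; x∉∁p⇒x∈p; x∈p⇒x∉∁p; x∉p⇒x∈∁p;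
         x∈p∧x∉q⇒x∈p─q; p─q⊆p; p─q─r≡p─r─q)
open import Data.List using (List; []; _∷_; _∷ʳ_)
open import Data.Product using (_×_; _,_; ∃; proj₁; proj₂)
open import Data.Vec.Base using ([]; _∷_; here; there)
open import Data.Empty using (⊥-elim)
open import Function.Bundles using (_⇔_; mk⇔; Equivalence)
open import Relation.Nullary using (yes; no)
open import Relation.Binary.PropositionalEquality using (_≡_; _≢_; refl; sym; cong; subst)

private
  variable
    n : ℕ

x∈p─q⇒x∉q : (p q : Subset n) {x : Fin n} → x ∈ p ─ q → x ∉ q
x∈p─q⇒x∉q (inside ∷ p) (outside ∷ q) here      ()
x∈p─q⇒x∉q (_ ∷ p)      (_ ∷ q)       (there m) (there m′) = x∈p─q⇒x∉q p q m m′

x∈p─q─r⇒x∈p─r─q : (p q r : Subset n) {x : Fin n} → x ∈ p ─ q ─ r → x ∈ p ─ r ─ q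
x∈p─q─r⇒x∈p─r─q p q r = subst (_ ∈_) (p─q─r≡p─r─q p q r)

⊤─p≡∁p : (p : Subset n) → ⊤ ─ p ≡ ∁ p
⊤─p≡∁p []            = refl
⊤─p≡∁p (inside ∷ p)  = cong (outside ∷_) (⊤─p≡∁p p)
⊤─p≡∁p (outside ∷ p) = cong (inside ∷_) (⊤─p≡∁p p)

q⊆p∧p≢q⇒Nonempty[p─q] : (p q : Subset n) → q ⊆ p → p ≢ q → Nonempty (p ─ q)
q⊆p∧p≢q⇒Nonempty[p─q] p q q⊆p p≢q with any? (λ x → x ∈? (p ─ q))
... | yes witness = witness
... | no  none    = ⊥-elim (p≢q (⊆-antisym p⊆q q⊆p))
  where
    p⊆q : p ⊆ q
    p⊆q {x} x∈p with x ∈? q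
    ... | yes x∈q = x∈q
    ... | no  x∉q = ⊥-elim (none (x , x∈p∧x∉q⇒x∈p─q x∈p x∉q))

module _ (G : Graph n) where

  Linked : Subset n → Set
  Linked C = ∀ u w → u ∈ C → w ∈ C → WalkIn G C u w

  walkIn-head : ∀ {C u w} → WalkIn G C u w → u ∈ C
  walkIn-head (here u∈C)      = u∈C
  walkIn-head (there u∈C _ _) = u∈C

  simplicial-shortcut : ∀ {S x u w} → SimplicialIn G S x → u ∈ S → w ∈ S → u ≢ w
                      → Adj G u x → Adj G x w → Adj G u w
  simplicial-shortcut (_ , nbhd-clique) u∈S w∈S u≢w ux xw =
    nbhd-clique _ _ u∈S w∈S u≢w (symAdj G ux) xw

  module _ {S L C : Subset n}
           (L-simplicial : ∀ {x} → x ∈ L → SimplicialIn G S x) (C⊆S : C ⊆ S) where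

    walkIn-avoiding : ∀ {u w} → u ∈ C ─ L → WalkIn G C u w → w ∉ L → WalkIn G (C ─ L) u w
    detour : ∀ {u x w} → u ∈ C ─ L → Adj G u x → WalkIn G C x w → w ∉ L
           → WalkIn G (C ─ L) u w

    walkIn-avoiding u∈C─L (here _)          _   = here u∈C─L
    walkIn-avoiding u∈C─L (there _ ux rest) w∉L = detour u∈C─L ux rest w∉L

    detour u∈C─L ux (here x∈C) w∉L = there u∈C─L ux (here (x∈p∧x∉q⇒x∈p─q x∈C w∉L))
    detour {u} {x} u∈C─L ux (there {v = y} x∈C xy rest) w∉L with x ∈? L
    ... | no x∉L = there u∈C─L ux (detour (x∈p∧x∉q⇒x∈p─q x∈C x∉L) xy rest w∉L)
    ... | yes x∈L with u ≟ y
    ...   | yes refl = walkIn-avoiding u∈C─L rest w∉L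
    ...   | no  u≢y  = detour u∈C─L uy rest w∉L
      where
        uy : Adj G u y
        uy = simplicial-shortcut (L-simplicial x∈L) (C⊆S (p─q⊆p C L u∈C─L))
                                 (C⊆S (walkIn-head rest)) u≢y ux xy

    linked-avoiding : Linked C → Linked (C ─ L)
    linked-avoiding linked u w u∈C─L w∈C─L =
      walkIn-avoiding u∈C─L (linked u w (p─q⊆p C L u∈C─L) (p─q⊆p C L w∈C─L))
                      (x∈p─q⇒x∉q C L w∈C─L)

    neighbour-avoiding : ∀ {v u w} → v ∈ S → v ∉ C → Adj G v u → WalkIn G C u w → w ∉ L
                       → ∃ λ u′ → u′ ∈ C ─ L × Adj G v u′
    neighbour-avoiding _ _ vu (here u∈C) w∉L = _ , x∈p∧x∉q⇒x∈p─q u∈C w∉L , vu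
    neighbour-avoiding {v} {u} v∈S v∉C vu (there {v = y} u∈C uy rest) w∉L with u ∈? L
    ... | no  u∉L = u , x∈p∧x∉q⇒x∈p─q u∈C u∉L , vu
    ... | yes u∈L = neighbour-avoiding v∈S v∉C vy rest w∉L
      where
        y∈C : y ∈ C
        y∈C = walkIn-head rest

        v≢y : v ≢ y
        v≢y refl = v∉C y∈C

        vy : Adj G v y
        vy = simplicial-shortcut (L-simplicial u∈L) v∈S (C⊆S y∈C) v≢y vu uy

  module _ {X : Subset n} where

    EvaporationLayer : Subset n → Subset n → Set
    EvaporationLayer S L = ∀ v → (v ∈ L) ⇔ (SimplicialIn G S v × v ∉ X)

    layer-simplicial : ∀ {S L x} → EvaporationLayer S L → x ∈ L → SimplicialIn G S x
    layer-simplicial layer x∈L = proj₁ (Equivalence.to (layer _) x∈L)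

    layer-disjoint : ∀ {S L x} → EvaporationLayer S L → x ∈ L → x ∉ X
    layer-disjoint layer x∈L = proj₂ (Equivalence.to (layer _) x∈L)

    exceptions-remain : ∀ {S L} → EvaporationLayer S L → X ⊆ S → X ⊆ S ─ L
    exceptions-remain layer X⊆S x∈X =
      x∈p∧x∉q⇒x∈p─q (X⊆S x∈X) (λ x∈L → layer-disjoint layer x∈L x∈X)

    nonempty-evap⇒≢ : ∀ {S} Ls {Lt} → Evap G X S (Ls ∷ʳ Lt) → S ≢ X
    nonempty-evap⇒≢ []      (step S≢X _ _) = S≢X
    nonempty-evap⇒≢ (_ ∷ _) (step S≢X _ _) = S≢X

    last-layer-disjoint : ∀ {S} Ls {Lt x} → Evap G X S (Ls ∷ʳ Lt) → x ∈ Lt → x ∉ X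
    last-layer-disjoint []      (step _ layer _) = layer-disjoint layer
    last-layer-disjoint (_ ∷ Ls) (step _ _ ev)   = last-layer-disjoint Ls ev

    neighbour-in-last-layer : ∀ {S} Ls {Lt v u} → Evap G X S (Ls ∷ʳ Lt) → X ⊆ S
                            → Linked (S ─ X) → v ∈ X → u ∈ S ─ X → Adj G v u
                            → ∃ λ u′ → u′ ∈ Lt × Adj G u′ v
    neighbour-in-last-layer {S} [] {Lt} {u = u} (step _ _ (done S─Lt≡X)) _ _ _ u∈S─X vu
      with u ∈? Lt
    ... | yes u∈Lt = u , u∈Lt , symAdj G vu
    ... | no  u∉Lt = ⊥-elim (x∈p─q⇒x∉q S X u∈S─X
                       (subst (u ∈_) S─Lt≡X (x∈p∧x∉q⇒x∈p─q (p─q⊆p S X u∈S─X) u∉Lt)))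
    neighbour-in-last-layer {S} (L ∷ Ls) {v = v} {u} (step _ layer ev) X⊆S linked v∈X u∈S─X vu =
      let (w , w∈S─L─X) = q⊆p∧p≢q⇒Nonempty[p─q] (S ─ L) X X⊆S─L (nonempty-evap⇒≢ Ls ev)
          w∈S─X─L = x∈p─q─r⇒x∈p─r─q S L X w∈S─L─X
          (u′ , u′∈S─X─L , vu′) =
            neighbour-avoiding L-simplicial (p─q⊆p S X) (X⊆S v∈X) v∉S─X vu
              (linked u w u∈S─X (p─q⊆p (S ─ X) L w∈S─X─L)) (x∈p─q⇒x∉q (S ─ X) L w∈S─X─L)
      in neighbour-in-last-layer Ls ev X⊆S─L linked′ v∈X (x∈p─q─r⇒x∈p─r─q S X L u′∈S─X─L) vu′
      where
        X⊆S─L : X ⊆ S ─ L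
        X⊆S─L = exceptions-remain layer X⊆S

        L-simplicial : ∀ {x} → x ∈ L → SimplicialIn G S x
        L-simplicial = layer-simplicial layer

        linked′ : Linked (S ─ L ─ X)
        linked′ = subst Linked (p─q─r≡p─r─q S X L)
                    (linked-avoiding L-simplicial (p─q⊆p S X) linked)

        v∉S─X : v ∉ S ─ X
        v∉S─X v∈S─X = x∈p─q⇒x∉q S X v∈S─X v∈X

lemma5p8 : {n : ℕ} (G : Graph n) (X : Subset n) → Chordal G → IsClique G X
    → ConnectedIn G (∁ X)
    → (Ls : List (Subset n)) (Lt : Subset n) → Evap G X ⊤ (Ls ∷ʳ Lt)
    → ∀ v → Nbhd G (∁ X) v ⇔ (Nbhd G Lt v × v ∈ X)
lemma5p8 G X _ _ (_ , connected) Ls Lt ev v = mk⇔ to from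
  where
    linked : Linked G (⊤ ─ X)
    linked = subst (Linked G) (sym (⊤─p≡∁p X)) connected

    to : Nbhd G (∁ X) v → Nbhd G Lt v × v ∈ X
    to (v∉∁X , u , u∈∁X , uv) =
      let v∈X = x∉∁p⇒x∈p v∉∁X
          (u′ , u′∈Lt , u′v) = neighbour-in-last-layer G Ls ev (λ _ → ∈⊤) linked v∈X
                                 (x∈p∧x∉q⇒x∈p─q ∈⊤ (x∈∁p⇒x∉p u∈∁X)) (symAdj G uv)
      in ((λ v∈Lt → last-layer-disjoint G Ls ev v∈Lt v∈X) , u′ , u′∈Lt , u′v) , v∈X

    from : Nbhd G Lt v × v ∈ X → Nbhd G (∁ X) v
    from ((_ , u , u∈Lt , uv) , v∈X) =
      x∈p⇒x∉∁p v∈X , u , x∉p⇒x∈∁p (last-layer-disjoint G Ls ev u∈Lt) , uv
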